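{- (a) For $n\geq 1$, the Catalan number $C_n=\frac{1}{n+1}\binom{2n}{n}$ equals the number of plane trees with $2n+1$ edges and $n+1$ old leaves. (b) For $n\ge 1$ and $1\le m\le\lfloor n/2\rfloor$, let $P_{ey}(n,m)$ (resp. $P_{oy}(n,m)$) be the number of plane trees with $n$ edges, $m$ old leaves and an even (resp. odd) number of young leaves. Then $P_{ey}(n,m)-P_{oy}(n,m)=0$.
   Context: A plane tree is an unlabeled rooted tree in which the children of every vertex are linearly ordered from left to right. A leaf is a vertex with no children. A leaf is an old leaf if it is the leftmost child of its parent (including a leaf that is the only child of its parent), and a young leaf otherwise. -}

module Defs where

open import Data.Nat using (ℕ; zero; suc; _+_; _*_; _%_; _/_)
open import Data.Nat.Combinatorics using (_C_)
open import Data.List using (List; []; _∷_)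
open import Data.Product using (Σ; _×_)
open import Relation.Binary.PropositionalEquality using (_≡_)

data PlaneTree : Set where
  node : List PlaneTree → PlaneTree

isLeaf : PlaneTree → ℕ
isLeaf (node []) = 1
isLeaf (node (_ ∷ _)) = 0

mutual
  edges : PlaneTree → ℕ
  edges (node ts) = edgesF ts

  edgesF : List PlaneTree → ℕ
  edgesF [] = 0
  edgesF (t ∷ ts) = suc (edges t) + edgesF ts

mutual
  -- number of old leaves: leaves that are the leftmost child of their parent
  oldLeaves : PlaneTree → ℕ
  oldLeaves (node []) = 0
  oldLeaves (node (t ∷ ts)) = isLeaf t + oldLeaves t + oldLeavesF ts

  oldLeavesF : List PlaneTree → ℕ
  oldLeavesF [] = 0
  oldLeavesF (t ∷ ts) = oldLeaves t + oldLeavesF ts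

mutual
  -- number of young leaves: leaves that are not the leftmost child of their parent
  youngLeaves : PlaneTree → ℕ
  youngLeaves (node []) = 0
  youngLeaves (node (t ∷ ts)) = youngLeaves t + youngLeavesF ts

  -- all trees in this list are non-leftmost children
  youngLeavesF : List PlaneTree → ℕ
  youngLeavesF [] = 0
  youngLeavesF (t ∷ ts) = isLeaf t + youngLeaves t + youngLeavesF ts

catalan : ℕ → ℕ
catalan n = ((2 * n) C n) / suc n

TreesA : ℕ → Set
TreesA n = Σ PlaneTree (λ t → (edges t ≡ suc (2 * n)) × (oldLeaves t ≡ suc n))

TreesEY : ℕ → ℕ → Set
TreesEY n m = Σ PlaneTree (λ t → (edges t ≡ n) × (oldLeaves t ≡ m) × (youngLeaves t % 2 ≡ 0))

TreesOY : ℕ → ℕ → Set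
TreesOY n m = Σ PlaneTree (λ t → (edges t ≡ n) × (oldLeaves t ≡ m) × (youngLeaves t % 2 ≡ 1))

{-# OPTIONS --safe #-}
module Submission where

-- (a) Giving every vertex a new leftmost leaf (sprout) turns a tree with n edges, hence n + 1 vertices, into
-- one with 2n + 1 edges and n + 1 old leaves. Since 2·(old leaves) ≤ edges + 1 for every tree, with equality
-- exactly when every leftmost child is a leaf, sprout is a bijection onto the trees of part (a). Trees with n
-- edges are counted through forests: dropping a first tree that is a single vertex, or else splitting it
-- into its leftmost subtree and the rest, gives the ballot-number recurrence, which at one tree is Catalan.
-- (b) A local move that deletes a young leaf and inserts an edge above some siblings (or conversely), applied
-- at a canonically chosen vertex, is an involution on the trees that do not attain the bound; it keeps edges
-- and old leaves and changes the number of young leaves by one, and m ≤ n/2 rules out the bound.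

open import Defs
open import Data.Fin using (Fin)
open import Data.Fin.Properties using (+↔⊎; 1↔⊤)
open import Data.List using (List; []; _∷_; length)
open import Data.Maybe using (Maybe; just; nothing)
open import Data.Nat using (ℕ; zero; suc; _+_; _*_; _≤_; _<_; z≤n; s≤s; _%_; _/_; _≟_)
open import Data.Nat.Combinatorics using (_C_; nCk≡nC[n∸k]; nC1≡n; nCk+nC[k+1]≡[n+1]C[k+1]; k>n⇒nCk≡0)
open import Data.Nat.DivMod using (m*n/n≡m; m/n*n≤m)
open import Data.Nat.Properties
open import Algebra.Properties.CommutativeSemigroup +-commutativeSemigroup using (interchange)
open import Data.Nat.Tactic.RingSolver using (solve-∀)
open import Data.Product using (Σ; _×_; _,_; proj₁; proj₂; ∃-syntax)
open import Data.Product.Function.Dependent.Propositional using (Σ-↔)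
open import Data.Sum using (_⊎_; inj₁; inj₂; [_,_]; swap)
open import Data.Sum.Function.Propositional using (_⊎-↔_)
open import Function using (_∘_)
open import Function.Bundles using (_↔_; _⇔_; mk↔ₛ′; mk⇔; Inverse; Equivalence)
open import Function.Properties.Inverse using (↔-refl; ↔-sym; ↔-trans)
open import Function.Related.TypeIsomorphisms using (Σ-assoc)
open import Relation.Nullary using (¬_; Dec; yes; no; contradiction)
open import Relation.Nullary.Decidable using (True-↔; _×-dec_)
open import Relation.Nullary.Irrelevant using (Irrelevant)
open import Relation.Unary using (Decidable)
open import Relation.Binary.PropositionalEquality hiding ([_])

×-irrelevant : ∀ {A B : Set} → Irrelevant A → Irrelevant B → Irrelevant (A × B)
×-irrelevant irrA irrB (a , b) (a′ , b′) = cong₂ _,_ (irrA a a′) (irrB b b′)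

≡×≡-irrelevant : ∀ {a b c d : ℕ} → Irrelevant (a ≡ b × c ≡ d)
≡×≡-irrelevant = ×-irrelevant ≡-irrelevant ≡-irrelevant

Σ-≡-irrelevant : ∀ {A : Set} {P : A → Set} → (∀ {x} → Irrelevant (P x)) →
                 ∀ {x y} {p : P x} {q : P y} → x ≡ y → (x , p) ≡ (y , q)
Σ-≡-irrelevant irr {p = p} {q} refl = cong (_ ,_) (irr p q)

Σ-↔-restrict : ∀ {A B : Set} {P : A → Set} {Q : B → Set} →
               (∀ {x} → Irrelevant (P x)) → (∀ {y} → Irrelevant (Q y)) →
               (f : A → B) (g : B → A) →
               (∀ x → P x → Q (f x)) → (∀ y → Q y → P (g y)) →
               (∀ x → P x → g (f x) ≡ x) → (∀ y → Q y → f (g y) ≡ y) →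
               Σ A P ↔ Σ B Q
Σ-↔-restrict irrP irrQ f g f-pres g-pres g∘f f∘g = mk↔ₛ′
  (λ (x , p) → f x , f-pres x p)
  (λ (y , q) → g y , g-pres y q)
  (λ (y , q) → Σ-≡-irrelevant irrQ (f∘g y q))
  (λ (x , p) → Σ-≡-irrelevant irrP (g∘f x p))

¬⇒↔Fin0 : ∀ {A : Set} → ¬ A → A ↔ Fin 0
¬⇒↔Fin0 ¬a = mk↔ₛ′ (λ a → contradiction a ¬a) (λ ()) (λ ()) (λ a → contradiction a ¬a)

dec-irrelevant⇒↔Fin : ∀ {A : Set} → Dec A → Irrelevant A → ∃[ k ] (A ↔ Fin k)
dec-irrelevant⇒↔Fin a?@(yes _) irr = 1 , ↔-trans (↔-sym (True-↔ a? irr)) (↔-sym 1↔⊤)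
dec-irrelevant⇒↔Fin (no ¬a)    irr = 0 , ¬⇒↔Fin0 ¬a

Σ-Fin-suc↔ : ∀ {N} {P : Fin (suc N) → Set} → Σ (Fin (suc N)) P ↔ (P Fin.zero ⊎ Σ (Fin N) (P ∘ Fin.suc))
Σ-Fin-suc↔ {N} {P} = mk↔ₛ′ to from [ (λ _ → refl) , (λ _ → refl) ] from∘to
  where
  to : Σ (Fin (suc N)) P → P Fin.zero ⊎ Σ (Fin N) (P ∘ Fin.suc)
  to (Fin.zero  , p) = inj₁ p
  to (Fin.suc i , p) = inj₂ (i , p)
  from : P Fin.zero ⊎ Σ (Fin N) (P ∘ Fin.suc) → Σ (Fin (suc N)) P
  from = [ (Fin.zero ,_) , (λ (i , p) → Fin.suc i , p) ]
  from∘to : ∀ x → from (to x) ≡ x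
  from∘to (Fin.zero  , _) = refl
  from∘to (Fin.suc _ , _) = refl

Σ-Fin-decidable↔Fin : ∀ N {P : Fin N → Set} → Decidable P → (∀ {i} → Irrelevant (P i)) →
                      ∃[ k ] (Σ (Fin N) P ↔ Fin k)
Σ-Fin-decidable↔Fin zero    P? irr = 0 , ¬⇒↔Fin0 (λ { (() , _) })
Σ-Fin-decidable↔Fin (suc N) P? irr =
  let (a , head↔) = dec-irrelevant⇒↔Fin (P? Fin.zero) irr
      (b , tail↔) = Σ-Fin-decidable↔Fin N (P? ∘ Fin.suc) irr
  in a + b , ↔-trans Σ-Fin-suc↔ (↔-trans (head↔ ⊎-↔ tail↔) (↔-sym +↔⊎))

Σ-decidable↔Fin : ∀ {A : Set} {N} {P : A → Set} → A ↔ Fin N → Decidable P →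
                  (∀ {x} → Irrelevant (P x)) → ∃[ k ] (Σ A P ↔ Fin k)
Σ-decidable↔Fin {N = N} A↔N P? irr =
  let (k , h) = Σ-Fin-decidable↔Fin N (P? ∘ from) irr
  in k , ↔-trans (↔-sym (Σ-↔ (↔-sym A↔N) ↔-refl)) h
  where open Inverse A↔N

pattern leaf = node []

Trees : ℕ → Set
Trees n = Σ PlaneTree λ t → edges t ≡ n

-- Lists of k plane trees; e = edgesF counts their edges plus one edge per tree, joining it to a common root.
Forest : ℕ → ℕ → Set
Forest k e = Σ (List PlaneTree) λ ts → length ts ≡ k × edgesF ts ≡ e

length≤edgesF : ∀ ts → length ts ≤ edgesF ts
length≤edgesF []       = z≤n
length≤edgesF (t ∷ ts) = s≤s (≤-trans (length≤edgesF ts) (m≤n+m (edgesF ts) (edges t)))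

¬Forest : ∀ {k e} → e < k → ¬ Forest k e
¬Forest e<k (ts , refl , refl) = <⇒≱ e<k (length≤edgesF ts)

edgesF-rotate : ∀ t ts rest → edgesF (t ∷ node ts ∷ rest) ≡ edgesF (node (t ∷ ts) ∷ rest)
edgesF-rotate t ts rest =
  cong suc (trans (+-suc (edges t) _) (cong suc (sym (+-assoc (edges t) (edgesF ts) (edgesF rest)))))

Forest-split : ∀ k e → Forest (suc k) (suc e) ↔ (Forest k e ⊎ Forest (suc (suc k)) (suc e))
Forest-split k e = mk↔ₛ′ to from to∘from from∘to
  where
  to : Forest (suc k) (suc e) → Forest k e ⊎ Forest (suc (suc k)) (suc e)
  to (leaf ∷ ts , l , s) = inj₁ (ts , suc-injective l , suc-injective s)
  to (node (t ∷ ts) ∷ rest , l , s) =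
    inj₂ (t ∷ node ts ∷ rest , cong suc l , trans (edgesF-rotate t ts rest) s)
  from : Forest k e ⊎ Forest (suc (suc k)) (suc e) → Forest (suc k) (suc e)
  from (inj₁ (ts , l , s)) = leaf ∷ ts , cong suc l , cong suc s
  from (inj₂ (t ∷ node ts ∷ rest , l , s)) =
    node (t ∷ ts) ∷ rest , suc-injective l , trans (sym (edgesF-rotate t ts rest)) s
  to∘from : ∀ y → to (from y) ≡ y
  to∘from (inj₁ _) = cong inj₁ (Σ-≡-irrelevant ≡×≡-irrelevant refl)
  to∘from (inj₂ (_ ∷ node _ ∷ _ , _)) = cong inj₂ (Σ-≡-irrelevant ≡×≡-irrelevant refl)
  from∘to : ∀ x → from (to x) ≡ x
  from∘to (leaf ∷ _ , _) = Σ-≡-irrelevant ≡×≡-irrelevant refl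
  from∘to (node (_ ∷ _) ∷ _ , _) = Σ-≡-irrelevant ≡×≡-irrelevant refl

forests : ℕ → ℕ → ℕ
forests _       zero    = 1
forests zero    (suc n) = 0
forests (suc k) (suc n) = forests k (suc n) + forests (suc (suc k)) n

Forest↔Fin : ∀ k n → Forest k (k + n) ↔ Fin (forests k n)
Forest↔Fin zero zero = mk↔ₛ′ (λ _ → Fin.zero) (λ _ → [] , refl , refl)
  (λ { Fin.zero → refl ; (Fin.suc ()) }) (λ { ([] , refl , refl) → refl })
Forest↔Fin zero (suc n) = ¬⇒↔Fin0 λ { ([] , refl , ()) }
Forest↔Fin (suc k) zero = ↔-trans (Forest-split k (k + 0))
  (↔-trans (Forest↔Fin k zero ⊎-↔ ¬⇒↔Fin0 (¬Forest (s≤s (s≤s (≤-reflexive (+-identityʳ k))))))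
           (↔-sym +↔⊎))
Forest↔Fin (suc k) (suc n) = ↔-trans (Forest-split k (k + suc n))
  (↔-trans (Forest↔Fin k (suc n) ⊎-↔ shifted) (↔-sym +↔⊎))
  where
  shifted : Forest (suc (suc k)) (suc (k + suc n)) ↔ Fin (forests (suc (suc k)) n)
  shifted = subst (λ e → Forest (suc (suc k)) e ↔ Fin (forests (suc (suc k)) n))
                  (sym (cong suc (+-suc k n))) (Forest↔Fin (suc (suc k)) n)

Trees↔Forest : ∀ n → Trees n ↔ Forest 1 (suc n)
Trees↔Forest n = mk↔ₛ′ to from to∘from from∘to
  where
  to : Trees n → Forest 1 (suc n)
  to (t , e) = t ∷ [] , refl , cong suc (trans (+-identityʳ _) e)
  from : Forest 1 (suc n) → Trees n
  from (t ∷ [] , _ , s) = t , trans (sym (+-identityʳ _)) (suc-injective s)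
  to∘from : ∀ y → to (from y) ≡ y
  to∘from (_ ∷ [] , _) = Σ-≡-irrelevant ≡×≡-irrelevant refl
  from∘to : ∀ x → from (to x) ≡ x
  from∘to _ = Σ-≡-irrelevant ≡-irrelevant refl

Trees↔Fin : ∀ n → Trees n ↔ Fin (forests 1 n)
Trees↔Fin n = ↔-trans (Trees↔Forest n) (Forest↔Fin 1 n)

[m+n]Cm≡[m+n]Cn : ∀ m n → (m + n) C m ≡ (m + n) C n
[m+n]Cm≡[m+n]Cn m n = trans (nCk≡nC[n∸k] (m≤m+n m n)) (cong ((m + n) C_) (m+n∸m≡n m n))

[1+k]*[1+n]C[1+k]≡[1+n]*nCk : ∀ n k → suc k * (suc n C suc k) ≡ suc n * (n C k)
[1+k]*[1+n]C[1+k]≡[1+n]*nCk zero zero = refl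
[1+k]*[1+n]C[1+k]≡[1+n]*nCk zero (suc k) = begin
  suc (suc k) * (1 C suc (suc k))
    ≡⟨ cong (suc (suc k) *_) (k>n⇒nCk≡0 {1} {suc (suc k)} (s≤s (s≤s z≤n))) ⟩
  suc (suc k) * 0                 ≡⟨ *-zeroʳ (suc (suc k)) ⟩
  0                               ≡⟨ cong (1 *_) (k>n⇒nCk≡0 {0} {suc k} (s≤s z≤n)) ⟨
  1 * (0 C suc k)                 ∎
  where open ≡-Reasoning
[1+k]*[1+n]C[1+k]≡[1+n]*nCk (suc n) zero =
  trans (+-identityʳ _) (trans (nC1≡n (suc (suc n))) (sym (*-identityʳ (suc (suc n)))))
[1+k]*[1+n]C[1+k]≡[1+n]*nCk (suc n) (suc k) = begin
  suc (suc k) * (suc (suc n) C suc (suc k)) ≡⟨ cong (suc (suc k) *_) (nCk+nC[k+1]≡[n+1]C[k+1] (suc n) (suc k)) ⟨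
  suc (suc k) * (a + b)                     ≡⟨ expand (suc k) a b ⟩
  suc k * a + a + suc (suc k) * b           ≡⟨ cong₂ (λ x y → x + a + y) ([1+k]*[1+n]C[1+k]≡[1+n]*nCk n k)
                                                                       ([1+k]*[1+n]C[1+k]≡[1+n]*nCk n (suc k)) ⟩
  suc n * c + a + suc n * d                 ≡⟨ collect (suc n) c d a ⟩
  suc n * (c + d) + a                       ≡⟨ cong (λ x → suc n * x + a) (nCk+nC[k+1]≡[n+1]C[k+1] n k) ⟩
  suc n * a + a                             ≡⟨ +-comm (suc n * a) a ⟩
  suc (suc n) * a                           ∎
  where
  open ≡-Reasoning
  a b c d : ℕ
  a = suc n C suc k
  b = suc n C suc (suc k)
  c = n C k
  d = n C suc k
  expand : ∀ k a b → suc k * (a + b) ≡ k * a + a + suc k * b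
  expand = solve-∀
  collect : ∀ n c d a → n * c + a + n * d ≡ n * (c + d) + a
  collect = solve-∀

[1+k]*[1+j+k]C[1+k]≡[1+j]*[1+j+k]Ck : ∀ j k → suc k * ((suc j + k) C suc k) ≡ suc j * ((suc j + k) C k)
[1+k]*[1+j+k]C[1+k]≡[1+j]*[1+j+k]Ck j k = begin
  suc k * (suc (j + k) C suc k)  ≡⟨ [1+k]*[1+n]C[1+k]≡[1+n]*nCk (j + k) k ⟩
  suc (j + k) * ((j + k) C k)    ≡⟨ cong (suc (j + k) *_) ([m+n]Cm≡[m+n]Cn j k) ⟨
  suc (j + k) * ((j + k) C j)    ≡⟨ [1+k]*[1+n]C[1+k]≡[1+n]*nCk (j + k) j ⟨
  suc j * (suc (j + k) C suc j)  ≡⟨ cong (suc j *_) ([m+n]Cm≡[m+n]Cn (suc j) k) ⟩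
  suc j * ((suc j + k) C k)      ∎
  where open ≡-Reasoning

-- Ballot numbers: forests k (1 + n) = w C (1 + n) − w C n for w = k + 2n + 1, stated without subtraction.
forests-ballot : ∀ k n → forests k (suc n) + (k + 2 * n + 1) C n ≡ (k + 2 * n + 1) C suc n
forests-ballot zero n = subst (λ w → w C n ≡ w C suc n) (width n) ([m+n]Cm≡[m+n]Cn n (suc n))
  where
  width : ∀ n → n + suc n ≡ 2 * n + 1
  width = solve-∀
forests-ballot (suc k) zero = begin
  forests k 1 + 1 + 1 ≡⟨ +-comm (forests k 1 + 1) 1 ⟩
  1 + (forests k 1 + 1) ≡⟨ cong (1 +_) (forests-ballot k zero) ⟩
  1 + w C 1           ≡⟨ nCk+nC[k+1]≡[n+1]C[k+1] w 0 ⟩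
  suc w C 1           ∎
  where
  open ≡-Reasoning
  w : ℕ
  w = k + 2 * 0 + 1
forests-ballot (suc k) (suc n) = begin
  A + B + suc w C suc n             ≡⟨ cong (A + B +_) (nCk+nC[k+1]≡[n+1]C[k+1] w n) ⟨
  A + B + (w C n + w C suc n)       ≡⟨ regroup A B (w C n) (w C suc n) ⟩
  (B + w C n) + (A + w C suc n)     ≡⟨ cong₂ _+_ ballot-inner (forests-ballot k (suc n)) ⟩
  w C suc n + w C suc (suc n)       ≡⟨ nCk+nC[k+1]≡[n+1]C[k+1] w (suc n) ⟩
  suc w C suc (suc n)               ∎
  where
  open ≡-Reasoning
  A B w : ℕ
  A = forests k (suc (suc n))
  B = forests (suc (suc k)) (suc n)
  w = k + 2 * suc n + 1
  width : ∀ k n → suc (suc k) + 2 * n + 1 ≡ k + 2 * suc n + 1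
  width = solve-∀
  ballot-inner : B + w C n ≡ w C suc n
  ballot-inner = subst (λ v → B + v C n ≡ v C suc n) (width k n) (forests-ballot (suc (suc k)) n)
  regroup : ∀ a b c d → a + b + (c + d) ≡ (b + c) + (a + d)
  regroup = solve-∀

forests-catalan : ∀ n → forests 1 n ≡ catalan n
forests-catalan zero = refl
forests-catalan (suc n) = begin
  X                       ≡⟨ m*n/n≡m X (suc (suc n)) ⟨
  X * suc (suc n) / suc (suc n) ≡⟨ cong (_/ suc (suc n)) X*[2+n]≡b ⟩
  b / suc (suc n)         ∎
  where
  open ≡-Reasoning
  X a b : ℕ
  X = forests 1 (suc n)
  a = (2 * suc n) C n
  b = (2 * suc n) C suc n
  ballot : X + a ≡ b
  ballot = subst (λ w → X + w C n ≡ w C suc n) (width n) (forests-ballot 1 n)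
    where
    width : ∀ n → 1 + 2 * n + 1 ≡ 2 * suc n
    width = solve-∀
  ratio : suc n * b ≡ suc (suc n) * a
  ratio = subst (λ w → suc n * (w C suc n) ≡ suc (suc n) * (w C n)) (width n)
                ([1+k]*[1+j+k]C[1+k]≡[1+j]*[1+j+k]Ck (suc n) n)
    where
    width : ∀ n → suc (suc n) + n ≡ 2 * suc n
    width = solve-∀
  X*[2+n]≡b : X * suc (suc n) ≡ b
  X*[2+n]≡b = +-cancelˡ-≡ (suc n * b) _ _ (begin
    suc n * b + X * suc (suc n)         ≡⟨ cong₂ _+_ ratio (*-comm X (suc (suc n))) ⟩
    suc (suc n) * a + suc (suc n) * X   ≡⟨ *-distribˡ-+ (suc (suc n)) a X ⟨
    suc (suc n) * (a + X)               ≡⟨ cong (suc (suc n) *_) (trans (+-comm a X) ballot) ⟩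
    suc (suc n) * b                     ≡⟨ +-comm b (suc n * b) ⟩
    suc n * b + b                       ∎)

+-≤-≡⇒≡ : ∀ {a b c d} → a ≤ b → c ≤ d → a + c ≡ b + d → a ≡ b × c ≡ d
+-≤-≡⇒≡ {a} {b} {c} {d} a≤b c≤d eq = a≡b , +-cancelˡ-≡ a c d (trans eq (cong (_+ d) (sym a≡b)))
  where
  a≡b : a ≡ b
  a≡b = ≤-antisym a≤b (+-cancelʳ-≤ d b a (subst (_≤ a + d) eq (+-monoʳ-≤ a c≤d)))

mutual
  oldLeaves-bound : ∀ t → oldLeaves t + oldLeaves t ≤ suc (edges t)
  oldLeaves-bound leaf = z≤n
  oldLeaves-bound (node (leaf ∷ ts)) =
    s≤s (subst (_≤ suc (edgesF ts)) (sym (+-suc (oldLeavesF ts) _)) (s≤s (oldLeavesF-bound ts)))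
  oldLeaves-bound (node (c@(node (_ ∷ _)) ∷ ts)) = m≤n⇒m≤1+n (oldLeavesF-bound (c ∷ ts))

  oldLeavesF-bound : ∀ ts → oldLeavesF ts + oldLeavesF ts ≤ edgesF ts
  oldLeavesF-bound [] = z≤n
  oldLeavesF-bound (t ∷ ts) = subst (_≤ edgesF (t ∷ ts)) (interchange (oldLeaves t) _ _ _)
    (+-mono-≤ (oldLeaves-bound t) (oldLeavesF-bound ts))

-- Equality in oldLeaves-bound: the trees in which every leftmost child is a leaf, i.e. the image of sprout.
Saturated : PlaneTree → Set
Saturated t = oldLeaves t + oldLeaves t ≡ suc (edges t)

mutual
  sprout : PlaneTree → PlaneTree
  sprout (node ts) = node (leaf ∷ sproutF ts)

  sproutF : List PlaneTree → List PlaneTree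
  sproutF []       = []
  sproutF (t ∷ ts) = sprout t ∷ sproutF ts

mutual
  prune : PlaneTree → PlaneTree
  prune (node (leaf ∷ ts)) = node (pruneF ts)
  prune _                  = leaf

  pruneF : List PlaneTree → List PlaneTree
  pruneF []       = []
  pruneF (t ∷ ts) = prune t ∷ pruneF ts

mutual
  prune-sprout : ∀ t → prune (sprout t) ≡ t
  prune-sprout (node ts) = cong node (pruneF-sproutF ts)

  pruneF-sproutF : ∀ ts → pruneF (sproutF ts) ≡ ts
  pruneF-sproutF []       = refl
  pruneF-sproutF (t ∷ ts) = cong₂ _∷_ (prune-sprout t) (pruneF-sproutF ts)

mutual
  edges-sprout : ∀ t → edges (sprout t) ≡ suc (2 * edges t)
  edges-sprout (node ts) = cong suc (edgesF-sproutF ts)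

  edgesF-sproutF : ∀ ts → edgesF (sproutF ts) ≡ 2 * edgesF ts
  edgesF-sproutF []       = refl
  edgesF-sproutF (t ∷ ts) =
    trans (cong₂ (λ x y → suc x + y) (edges-sprout t) (edgesF-sproutF ts)) (double-+ (edges t) (edgesF ts))
    where
    double-+ : ∀ x y → suc (suc (2 * x)) + 2 * y ≡ 2 * (suc x + y)
    double-+ = solve-∀

mutual
  oldLeaves-sprout : ∀ t → oldLeaves (sprout t) ≡ suc (edges t)
  oldLeaves-sprout (node ts) = cong suc (oldLeavesF-sproutF ts)

  oldLeavesF-sproutF : ∀ ts → oldLeavesF (sproutF ts) ≡ edgesF ts
  oldLeavesF-sproutF []       = refl
  oldLeavesF-sproutF (t ∷ ts) = cong₂ _+_ (oldLeaves-sprout t) (oldLeavesF-sproutF ts)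

mutual
  sprout-prune : ∀ t → Saturated t → sprout (prune t) ≡ t
  sprout-prune (node (leaf ∷ ts)) sat =
    cong (node ∘ (leaf ∷_)) (sproutF-pruneF ts (suc-injective (trans (sym (+-suc _ _)) (suc-injective sat))))
  sprout-prune (node (c@(node (_ ∷ _)) ∷ ts)) sat =
    contradiction (subst (_≤ edgesF (c ∷ ts)) sat (oldLeavesF-bound (c ∷ ts))) 1+n≰n

  sproutF-pruneF : ∀ ts → oldLeavesF ts + oldLeavesF ts ≡ edgesF ts → sproutF (pruneF ts) ≡ ts
  sproutF-pruneF []       _   = refl
  sproutF-pruneF (t ∷ ts) sat = cong₂ _∷_ (sprout-prune t (proj₁ split)) (sproutF-pruneF ts (proj₂ split))
    where
    split : Saturated t × oldLeavesF ts + oldLeavesF ts ≡ edgesF ts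
    split = +-≤-≡⇒≡ (oldLeaves-bound t) (oldLeavesF-bound ts) (trans (interchange (oldLeaves t) _ _ _) sat)

TreesA↔Trees : ∀ n → TreesA n ↔ Trees n
TreesA↔Trees n = Σ-↔-restrict ≡×≡-irrelevant ≡-irrelevant prune sprout
  edges-prune
  (λ s e → trans (edges-sprout s) (cong (suc ∘ (2 *_)) e) , trans (oldLeaves-sprout s) (cong suc e))
  (λ t p → sprout-prune t (saturated t p))
  (λ s _ → prune-sprout s)
  where
  saturated : ∀ t → edges t ≡ suc (2 * n) × oldLeaves t ≡ suc n → Saturated t
  saturated _ (e , o) = trans (cong₂ _+_ o o) (trans (double n) (cong suc (sym e)))
    where
    double : ∀ n → suc n + suc n ≡ suc (suc (2 * n))
    double = solve-∀
  edges-prune : ∀ t → edges t ≡ suc (2 * n) × oldLeaves t ≡ suc n → edges (prune t) ≡ n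
  edges-prune t p@(e , _) = *-cancelˡ-≡ _ _ 2 (suc-injective (begin
    suc (2 * edges (prune t)) ≡⟨ edges-sprout (prune t) ⟨
    edges (sprout (prune t))  ≡⟨ cong edges (sprout-prune t (saturated t p)) ⟩
    edges t                   ≡⟨ e ⟩
    suc (2 * n)               ∎))
    where open ≡-Reasoning

TreesA↔Fin : ∀ n → TreesA n ↔ Fin (catalan n)
TreesA↔Fin n = subst (λ k → TreesA n ↔ Fin k) (forests-catalan n) (↔-trans (TreesA↔Trees n) (Trees↔Fin n))

Adjacent : ℕ → ℕ → Set
Adjacent a b = a ≡ suc b ⊎ b ≡ suc a

+-adjacentˡ : ∀ k {a b} → Adjacent a b → Adjacent (k + a) (k + b)
+-adjacentˡ k {a} {b} (inj₁ refl) = inj₁ (+-suc k b)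
+-adjacentˡ k {a} {b} (inj₂ refl) = inj₂ (+-suc k a)

+-adjacentʳ : ∀ k {a b} → Adjacent a b → Adjacent (a + k) (b + k)
+-adjacentʳ k {a} {b} = subst₂ Adjacent (+-comm k a) (+-comm k b) ∘ +-adjacentˡ k

even⇔odd-suc : ∀ a → a % 2 ≡ 0 ⇔ suc a % 2 ≡ 1
even⇔odd-suc zero          = mk⇔ (λ _ → refl) (λ _ → refl)
even⇔odd-suc (suc zero)    = mk⇔ (λ ()) (λ ())
even⇔odd-suc (suc (suc a)) = even⇔odd-suc a

odd⇔even-suc : ∀ a → a % 2 ≡ 1 ⇔ suc a % 2 ≡ 0
odd⇔even-suc zero          = mk⇔ (λ ()) (λ ())
odd⇔even-suc (suc zero)    = mk⇔ (λ _ → refl) (λ _ → refl)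
odd⇔even-suc (suc (suc a)) = odd⇔even-suc a

adjacent-even⇒odd : ∀ {a b} → Adjacent a b → b % 2 ≡ 0 → a % 2 ≡ 1
adjacent-even⇒odd {b = b} (inj₁ refl) = Equivalence.to (even⇔odd-suc b)
adjacent-even⇒odd {a = a} (inj₂ refl) = Equivalence.from (odd⇔even-suc a)

adjacent-odd⇒even : ∀ {a b} → Adjacent a b → b % 2 ≡ 1 → a % 2 ≡ 0
adjacent-odd⇒even {b = b} (inj₁ refl) = Equivalence.to (odd⇔even-suc b)
adjacent-odd⇒even {a = a} (inj₂ refl) = Equivalence.from (even⇔odd-suc a)

YoungAdjacent : PlaneTree → PlaneTree → Set
YoungAdjacent s t = edges s ≡ edges t × oldLeaves s ≡ oldLeaves t × Adjacent (youngLeaves s) (youngLeaves t)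

YoungAdjacent-sym : ∀ {s t} → YoungAdjacent s t → YoungAdjacent t s
YoungAdjacent-sym (e , o , y) = sym e , sym o , swap y

YoungAdjacent-contract : ∀ c l → YoungAdjacent (node (c ∷ leaf ∷ l)) (node (node (c ∷ l) ∷ []))
YoungAdjacent-contract c l =
  trans (+-suc (suc (edges c)) (edgesF l)) (sym (+-identityʳ _)) ,
  sym (+-identityʳ _) ,
  inj₁ (trans (+-suc (youngLeaves c) _) (cong suc (sym (+-identityʳ _))))

module _ (c : PlaneTree) (a : PlaneTree) (as rest : List PlaneTree) where
  private T = node (a ∷ as)

  edges-insert : edges (node (c ∷ T ∷ rest)) ≡ suc (edges T) + edges (node (c ∷ rest))
  edges-insert = swap-+ (edges c) (edges T) (edgesF rest)
    where
    swap-+ : ∀ x y z → suc x + (suc y + z) ≡ suc y + (suc x + z)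
    swap-+ = solve-∀

  oldLeaves-insert : oldLeaves (node (c ∷ T ∷ rest)) ≡ oldLeaves T + oldLeaves (node (c ∷ rest))
  oldLeaves-insert = swap-+ (isLeaf c + oldLeaves c) (oldLeaves T) (oldLeavesF rest)
    where
    swap-+ : ∀ x y z → x + (y + z) ≡ y + (x + z)
    swap-+ = solve-∀

  youngLeaves-insert : youngLeaves (node (c ∷ T ∷ rest)) ≡ youngLeaves T + youngLeaves (node (c ∷ rest))
  youngLeaves-insert = swap-+ (youngLeaves c) (youngLeaves T) (youngLeavesF rest)
    where
    swap-+ : ∀ x y z → x + (y + z) ≡ y + (x + z)
    swap-+ = solve-∀

YoungAdjacent-child : ∀ c a as a′ as′ rest → YoungAdjacent (node (a′ ∷ as′)) (node (a ∷ as)) →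
                      YoungAdjacent (node (c ∷ node (a′ ∷ as′) ∷ rest)) (node (c ∷ node (a ∷ as) ∷ rest))
YoungAdjacent-child c a as a′ as′ rest (e , o , y) =
  cong (λ x → suc (edges c) + (suc x + edgesF rest)) e ,
  cong (λ x → isLeaf c + oldLeaves c + (x + oldLeavesF rest)) o ,
  +-adjacentˡ (youngLeaves c) (+-adjacentʳ (youngLeavesF rest) y)

YoungAdjacent-insert : ∀ c′ rest′ c a as rest → YoungAdjacent (node (c′ ∷ rest′)) (node (c ∷ rest)) →
                        YoungAdjacent (node (c′ ∷ node (a ∷ as) ∷ rest′)) (node (c ∷ node (a ∷ as) ∷ rest))
YoungAdjacent-insert c′ rest′ c a as rest (e , o , y) =
  subst₂ _≡_ (sym (edges-insert c′ a as rest′)) (sym (edges-insert c a as rest))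
    (cong (suc (edges (node (a ∷ as))) +_) e) ,
  subst₂ _≡_ (sym (oldLeaves-insert c′ a as rest′)) (sym (oldLeaves-insert c a as rest))
    (cong (oldLeaves (node (a ∷ as)) +_) o) ,
  subst₂ Adjacent (sym (youngLeaves-insert c′ a as rest′)) (sym (youngLeaves-insert c a as rest))
    (+-adjacentˡ (youngLeaves (node (a ∷ as))) y)

Saturated-insert : ∀ c a as rest → Saturated (node (a ∷ as)) → Saturated (node (c ∷ rest)) →
                   Saturated (node (c ∷ node (a ∷ as) ∷ rest))
Saturated-insert c a as rest satT satR = begin
  O + O                         ≡⟨ cong (λ x → x + x) (oldLeaves-insert c a as rest) ⟩
  (oT + oR) + (oT + oR)         ≡⟨ interchange oT oR oT oR ⟩
  (oT + oT) + (oR + oR)         ≡⟨ cong₂ _+_ satT satR ⟩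
  suc eT + suc eR               ≡⟨ +-suc (suc eT) eR ⟩
  suc (suc eT + eR)             ≡⟨ cong suc (edges-insert c a as rest) ⟨
  suc (edges (node (c ∷ node (a ∷ as) ∷ rest))) ∎
  where
  open ≡-Reasoning
  O oT oR eT eR : ℕ
  O = oldLeaves (node (c ∷ node (a ∷ as) ∷ rest))
  oT = oldLeaves (node (a ∷ as))
  oR = oldLeaves (node (c ∷ rest))
  eT = edges (node (a ∷ as))
  eR = edges (node (c ∷ rest))

-- On the children c ∷ l of a vertex, toggle performs the move  c ∷ Ts ++ leaf ∷ l  ↔  node (c ∷ l) ∷ Ts,
-- where Ts are the following internal children, inside each of which toggle has failed.
toggle : PlaneTree → List PlaneTree → Maybe (PlaneTree × List PlaneTree)
toggle c              (leaf ∷ l) = just (node (c ∷ l) , [])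
toggle c (node (a ∷ as) ∷ rest) with toggle a as
... | just (a′ , as′) = just (c , node (a′ ∷ as′) ∷ rest)
... | nothing with toggle c rest
...   | just (c′ , rest′) = just (c′ , node (a ∷ as) ∷ rest′)
...   | nothing           = nothing
toggle leaf           []         = nothing
toggle (node (d ∷ r)) []         = just (d , leaf ∷ r)

toggle-involutive : ∀ c l {c′ l′} → toggle c l ≡ just (c′ , l′) → toggle c′ l′ ≡ just (c , l)
toggle-involutive c (leaf ∷ _) refl = refl
toggle-involutive c (node (a ∷ as) ∷ rest) eq with toggle a as in eq-a
toggle-involutive c (node (a ∷ as) ∷ rest) refl | just (a′ , as′)
  rewrite toggle-involutive a as eq-a = refl
... | nothing with toggle c rest in eq-c
toggle-involutive c (node (a ∷ as) ∷ rest) refl | nothing | just (c′ , rest′)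
  rewrite eq-a | toggle-involutive c rest eq-c = refl
toggle-involutive (node (_ ∷ _)) [] refl = refl

toggle-YoungAdjacent : ∀ c l {c′ l′} → toggle c l ≡ just (c′ , l′) →
                       YoungAdjacent (node (c′ ∷ l′)) (node (c ∷ l))
toggle-YoungAdjacent c (leaf ∷ l) refl =
  YoungAdjacent-sym {node (c ∷ leaf ∷ l)} {node (node (c ∷ l) ∷ [])} (YoungAdjacent-contract c l)
toggle-YoungAdjacent c (node (a ∷ as) ∷ rest) eq with toggle a as in eq-a
toggle-YoungAdjacent c (node (a ∷ as) ∷ rest) refl | just (a′ , as′) =
  YoungAdjacent-child c a as a′ as′ rest (toggle-YoungAdjacent a as eq-a)
... | nothing with toggle c rest in eq-c
toggle-YoungAdjacent c (node (a ∷ as) ∷ rest) refl | nothing | just (c′ , rest′) =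
  YoungAdjacent-insert c′ rest′ c a as rest (toggle-YoungAdjacent c rest eq-c)
toggle-YoungAdjacent (node (d ∷ r)) [] refl = YoungAdjacent-contract d r

toggle-nothing : ∀ c l → toggle c l ≡ nothing → Saturated (node (c ∷ l))
toggle-nothing leaf           []         _ = refl
toggle-nothing (node (_ ∷ _)) []         ()
toggle-nothing c              (leaf ∷ _) ()
toggle-nothing c (node (a ∷ as) ∷ rest) with toggle a as | toggle-nothing a as
... | just _  | _ = λ ()
... | nothing | satT with toggle c rest | toggle-nothing c rest
...   | just _  | _    = λ ()
...   | nothing | satR = λ _ → Saturated-insert c a as rest (satT refl) (satR refl)

toggleTree : PlaneTree → PlaneTree
toggleTree leaf = leaf
toggleTree (node (c ∷ l)) with toggle c l
... | just (c′ , l′) = node (c′ ∷ l′)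
... | nothing        = node (c ∷ l)

toggleTree-involutive : ∀ t → toggleTree (toggleTree t) ≡ t
toggleTree-involutive leaf = refl
toggleTree-involutive (node (c ∷ l)) with toggle c l in eq
... | just (_ , _) rewrite toggle-involutive c l eq = refl
... | nothing      rewrite eq                       = refl

toggleTree-YoungAdjacent : ∀ t → 1 ≤ edges t → ¬ Saturated t → YoungAdjacent (toggleTree t) t
toggleTree-YoungAdjacent (node (c ∷ l)) _ ¬sat with toggle c l in eq
... | just (_ , _) = toggle-YoungAdjacent c l eq
... | nothing      = contradiction (toggle-nothing c l eq) ¬sat

TreesEY↔TreesOY : ∀ {n m} → 1 ≤ n → m + m ≤ n → TreesEY n m ↔ TreesOY n m
TreesEY↔TreesOY {n} {m} 1≤n 2m≤n = Σ-↔-restrict irrelevant irrelevant toggleTree toggleTree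
  (preserves adjacent-even⇒odd) (preserves adjacent-odd⇒even)
  (λ t _ → toggleTree-involutive t)
  (λ t _ → toggleTree-involutive t)
  where
  irrelevant : ∀ {a b c d e f : ℕ} → Irrelevant (a ≡ b × c ≡ d × e ≡ f)
  irrelevant = ×-irrelevant ≡-irrelevant ≡×≡-irrelevant
  adjacent : ∀ t → edges t ≡ n → oldLeaves t ≡ m → YoungAdjacent (toggleTree t) t
  adjacent t refl refl = toggleTree-YoungAdjacent t 1≤n λ sat → 1+n≰n (subst (_≤ edges t) sat 2m≤n)
  preserves : ∀ {p q} → (∀ {a b} → Adjacent a b → b % 2 ≡ p → a % 2 ≡ q) →
              ∀ t → edges t ≡ n × oldLeaves t ≡ m × youngLeaves t % 2 ≡ p →
              edges (toggleTree t) ≡ n × oldLeaves (toggleTree t) ≡ m × youngLeaves (toggleTree t) % 2 ≡ q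
  preserves parity t (e , o , y) =
    let (e′ , o′ , adj) = adjacent t e o in trans e′ e , trans o′ o , parity adj y

TreesEY↔Fin : ∀ n m → ∃[ k ] (TreesEY n m ↔ Fin k)
TreesEY↔Fin n m =
  let (k , h) = Σ-decidable↔Fin (Trees↔Fin n)
                  (λ (t , _) → (oldLeaves t ≟ m) ×-dec (youngLeaves t % 2 ≟ 0)) ≡×≡-irrelevant
  in k , ↔-trans (↔-sym Σ-assoc) h

m≤n/2⇒m+m≤n : ∀ {m n} → m ≤ n / 2 → m + m ≤ n
m≤n/2⇒m+m≤n {m} {n} m≤n/2 = begin
  m + m     ≡⟨ double m ⟩
  m * 2     ≤⟨ *-monoˡ-≤ 2 m≤n/2 ⟩
  n / 2 * 2 ≤⟨ m/n*n≤m n 2 ⟩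
  n         ∎
  where
  open ≤-Reasoning
  double : ∀ m → m + m ≡ m * 2
  double = solve-∀

corollary1p13 : ((n : ℕ) → 1 ≤ n → TreesA n ↔ Fin (catalan n))
    × ((n m : ℕ) → 1 ≤ n → 1 ≤ m → m ≤ n / 2
    → ∃[ k ] ((TreesEY n m ↔ Fin k) × (TreesOY n m ↔ Fin k)))
corollary1p13 =
  (λ n _ → TreesA↔Fin n) ,
  λ n m 1≤n _ m≤n/2 →
    let (k , EY↔k) = TreesEY↔Fin n m
    in k , EY↔k , ↔-trans (↔-sym (TreesEY↔TreesOY 1≤n (m≤n/2⇒m+m≤n m≤n/2))) EY↔k
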